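{- Let $\mathbb{K}$ be a totally ordered field which is Cantor complete but not algebraically saturated. Then (i) $\mathbb{K}$ has an increasing unbounded sequence; and (ii) $\mathbb{K}$ is sequentially complete.
   Context: $\mathbb{K}$ is Cantor complete if every countable family of closed bounded intervals in $\mathbb{K}$ with the finite intersection property has non-empty intersection. $\mathbb{K}$ is algebraically saturated if every countable family of open intervals in $\mathbb{K}$ with the finite intersection property has non-empty intersection. Sequentially complete: every Cauchy sequence converges in the order topology, where $(a_n)$ is Cauchy if for every $\epsilon>0$ in $\mathbb{K}$ there is $N$ with $|a_n-a_m|<\epsilon$ for all $n,m\ge N$. -}

module Defs where

open import Level using (Level; suc; _⊔_)
open import Data.Nat using (ℕ) renaming (_≤_ to _≤ℕ_; suc to sucℕ)
open import Data.List using (List)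
open import Data.List.Relation.Unary.All using (All)
open import Data.Product using (Σ; ∃; _×_)
open import Relation.Nullary using (¬_)
open import Relation.Binary.PropositionalEquality using (_≡_)
open import Relation.Binary.Structures using (IsTotalOrder)
open import Algebra.Structures using (IsCommutativeRing)

record OrderedField (ℓ : Level) : Set (suc ℓ) where
  infixl 6 _+_
  infixl 7 _*_
  infix 4 _≤_ _<_
  field
    Carrier : Set ℓ
    _+_ _*_ : Carrier → Carrier → Carrier
    -_      : Carrier → Carrier
    0# 1#   : Carrier
    _≤_     : Carrier → Carrier → Set ℓ
    isCommutativeRing : IsCommutativeRing _≡_ _+_ _*_ -_ 0# 1#
    0≢1     : ¬ (0# ≡ 1#)
    inverse : ∀ x → ¬ (x ≡ 0#) → ∃ λ y → x * y ≡ 1#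
    isTotalOrder : IsTotalOrder _≡_ _≤_
    +-mono-≤ : ∀ {x y} z → x ≤ y → x + z ≤ y + z
    *-nonneg : ∀ {x y} → 0# ≤ x → 0# ≤ y → 0# ≤ x * y

  _<_ : Carrier → Carrier → Set ℓ
  x < y = (x ≤ y) × ¬ (x ≡ y)

  _-_ : Carrier → Carrier → Carrier
  x - y = x + (- y)

  ∣_∣<_ : Carrier → Carrier → Set ℓ
  ∣ x ∣< ε = (- ε < x) × (x < ε)

module _ {ℓ : Level} (K : OrderedField ℓ) where
  open OrderedField K

  _∈[_,_] : Carrier → Carrier → Carrier → Set ℓ
  x ∈[ a , b ] = (a ≤ x) × (x ≤ b)

  _∈⟨_,_⟩ : Carrier → Carrier → Carrier → Set ℓ
  x ∈⟨ a , b ⟩ = (a < x) × (x < b)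

  ClosedFIP : (ℕ → Carrier) → (ℕ → Carrier) → Set ℓ
  ClosedFIP a b = (F : List ℕ) → ∃ λ x → All (λ i → x ∈[ a i , b i ]) F

  OpenFIP : (ℕ → Carrier) → (ℕ → Carrier) → Set ℓ
  OpenFIP a b = (F : List ℕ) → ∃ λ x → All (λ i → x ∈⟨ a i , b i ⟩) F

  CantorComplete : Set ℓ
  CantorComplete = (a b : ℕ → Carrier) → ClosedFIP a b →
                   ∃ λ x → ∀ i → x ∈[ a i , b i ]

  AlgebraicallySaturated : Set ℓ
  AlgebraicallySaturated = (a b : ℕ → Carrier) → OpenFIP a b →
                           ∃ λ x → ∀ i → x ∈⟨ a i , b i ⟩

  StrictlyIncreasing : (ℕ → Carrier) → Set ℓ
  StrictlyIncreasing s = ∀ n → s n < s (sucℕ n)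

  Unbounded : (ℕ → Carrier) → Set ℓ
  Unbounded s = ∀ c → ∃ λ n → c < s n

  Cauchy : (ℕ → Carrier) → Set ℓ
  Cauchy s = ∀ ε → 0# < ε → ∃ λ N → ∀ n m → N ≤ℕ n → N ≤ℕ m → ∣ s n - s m ∣< ε

  ConvergesTo : (ℕ → Carrier) → Carrier → Set ℓ
  ConvergesTo s L = ∀ ε → 0# < ε → ∃ λ N → ∀ n → N ≤ℕ n → ∣ s n - L ∣< ε

  SequentiallyComplete : Set ℓ
  SequentiallyComplete = (s : ℕ → Carrier) → Cauchy s → ∃ λ L → ConvergesTo s L

module Submission where

-- The heart of the proof is the observation that Cantor completeness plus
-- "every sequence is bounded above" already implies algebraic saturation: if
-- a k < b j for all k, j, the reciprocals of the gaps b j - a k form a bounded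
-- double sequence, so the gaps have a positive lower bound 2δ, and a point of
-- the shrunken closed intervals [a i + δ , b i - δ] (given by Cantor
-- completeness) lies in every open interval (a i , b i).  Classically, a field
-- that is not saturated therefore has an unbounded sequence u.
--
-- From u we build (i) a strictly increasing majorant of u, and (ii) the
-- arbitrarily small positive sequence 1 / max (u k) 1; with it, the limit of a
-- Cauchy sequence s is a point common to the closed intervals of radius e k
-- around the terms s (N k) from which s stays e k-close.

open import Defs
open import Level using (Level)
open import Data.Product using (∃; _×_)
open import Relation.Nullary using (¬_)
open import Axiom.ExcludedMiddle using (ExcludedMiddle)

open import Data.Product using (_,_; proj₁; proj₂)
open import Data.Sum using (inj₁; inj₂)
open import Data.Empty using (⊥-elim)
open import Data.List using (List; []; _∷_)
open import Data.List.Relation.Unary.All as All using (All; []; _∷_)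
open import Data.Nat using (ℕ; zero) renaming (_≤_ to _≤ℕ_; suc to sucℕ)
import Data.Nat.Properties as ℕ
open import Relation.Nullary using (yes; no)
open import Relation.Binary.PropositionalEquality
  using (_≡_; sym; trans; cong; cong₂; subst; module ≡-Reasoning)
open import Relation.Binary.Bundles using (TotalOrder; TotalPreorder)
open import Relation.Binary.Structures using (IsTotalOrder)
open import Algebra.Structures using (IsCommutativeRing)
open import Algebra.Bundles using (CommutativeRing)
open import Axiom.DoubleNegationElimination using (em⇒dne)
import Algebra.Properties.Ring as RingProperties
import Algebra.Properties.CommutativeSemigroup as CommutativeSemigroupProperties
import Algebra.Construct.NaturalChoice.Max as NaturalMax
import Relation.Binary.Reasoning.PartialOrder as PartialOrderReasoning

-- This is how the finite
-- intersection property is verified for the interval families below.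
module _ {a ℓ₁ ℓ₂} (P : TotalPreorder a ℓ₁ ℓ₂) where
  open TotalPreorder P using (Carrier; _≲_; total) renaming (refl to ≲-refl; trans to ≲-trans)

  dominatingIndex : (f : ℕ → Carrier) (F : List ℕ) → ∃ λ k → All (λ i → f i ≲ f k) F
  dominatingIndex f [] = zero , []
  dominatingIndex f (i ∷ F) with dominatingIndex f F
  ... | k , below-k with total (f i) (f k)
  ... | inj₁ fi≲fk = k , fi≲fk ∷ below-k
  ... | inj₂ fk≲fi = i , ≲-refl ∷ All.map (λ fj≲fk → ≲-trans fj≲fk fk≲fi) below-k

module OrderedFieldFacts {ℓ : Level} (K : OrderedField ℓ) where
  open OrderedField K
  open IsCommutativeRing isCommutativeRing public
    using ( +-assoc; +-comm; +-identityˡ; +-identityʳ; *-assoc; *-comm; *-identityˡ; *-identityʳ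
          ; distribˡ; distribʳ; zeroʳ)
  open IsTotalOrder isTotalOrder public
    using (total; antisym) renaming (refl to ≤-refl; trans to ≤-trans; reflexive to ≤-reflexive)

  commutativeRing : CommutativeRing ℓ ℓ
  commutativeRing = record { isCommutativeRing = isCommutativeRing }

  open RingProperties (CommutativeRing.ring commutativeRing)
    using ( //-rightDividesˡ; //-rightDividesʳ; +-cancelʳ; -‿involutive; -0#≈0#; -‿+-comm
          ; -‿distribˡ-*; -‿distribʳ-*; [y-z]x≈yx-zx)
  open CommutativeSemigroupProperties (CommutativeRing.*-commutativeSemigroup commutativeRing)
    using (x∙yz≈y∙xz)

  totalOrder : TotalOrder ℓ ℓ ℓ
  totalOrder = record { isTotalOrder = isTotalOrder }

  open TotalOrder totalOrder public using (totalPreorder)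
  open NaturalMax totalOrder public using (_⊔_; x≤x⊔y; x≤y⊔x)

  -- Chains mixing ≤, < and ≡ (the strict order of Defs is the one derived
  -- from ≤ by Relation.Binary.Construct.NonStrictToStrict).
  module ≤-Reasoning = PartialOrderReasoning (TotalOrder.poset totalOrder)

  <-≤-trans : ∀ {x y z} → x < y → y ≤ z → x < z
  <-≤-trans {x} {y} {z} x<y y≤z = begin-strict x <⟨ x<y ⟩ y ≤⟨ y≤z ⟩ z ∎
    where open ≤-Reasoning

  ≤-<-trans : ∀ {x y z} → x ≤ y → y < z → x < z
  ≤-<-trans {x} {y} {z} x≤y y<z = begin-strict x ≤⟨ x≤y ⟩ y <⟨ y<z ⟩ z ∎
    where open ≤-Reasoning

  +-mono-< : ∀ {x y} z → x < y → x + z < y + z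
  +-mono-< z (x≤y , x≢y) = +-mono-≤ z x≤y , λ eq → x≢y (+-cancelʳ z _ _ eq)

  +-mono-≤₂ : ∀ {x y u v} → x ≤ y → u ≤ v → x + u ≤ y + v
  +-mono-≤₂ {x} {y} {u} {v} x≤y u≤v = begin
    x + u ≤⟨ +-mono-≤ u x≤y ⟩
    y + u ≡⟨ +-comm y u ⟩
    u + y ≤⟨ +-mono-≤ y u≤v ⟩
    v + y ≡⟨ +-comm v y ⟩
    y + v ∎
    where open ≤-Reasoning

  module Moving (_R_ : Carrier → Carrier → Set ℓ)
                (R-translate : ∀ {x y} z → x R y → (x + z) R (y + z)) where

    subtractʳ : ∀ {x y z} → x R (y + z) → (x - z) R y
    subtractʳ {x} {y} {z} h = subst ((x - z) R_) (//-rightDividesʳ z y) (R-translate (- z) h)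

    addʳ : ∀ {x y z} → (x - z) R y → x R (y + z)
    addʳ {x} {y} {z} h = subst (_R (y + z)) (//-rightDividesˡ z x) (R-translate z h)

    subtractˡ : ∀ {x y z} → (x + z) R y → x R (y - z)
    subtractˡ {x} {y} {z} h = subst (_R (y - z)) (//-rightDividesʳ z x) (R-translate (- z) h)

    addˡ : ∀ {x y z} → x R (y - z) → (x + z) R y
    addˡ {x} {y} {z} h = subst ((x + z) R_) (//-rightDividesˡ z y) (R-translate z h)

    toDifference : ∀ {x y} → x R y → 0# R (y - x)
    toDifference {x} {y} h = subtractˡ (subst (_R y) (sym (+-identityˡ x)) h)

    fromDifference : ∀ {x y} → 0# R (y - x) → x R y
    fromDifference {x} {y} h = subst (_R y) (+-identityˡ x) (addˡ h)

  module ≤ = Moving _≤_ +-mono-≤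
  module < = Moving _<_ +-mono-<

  -‿antitone : ∀ {x y} → x ≤ y → - y ≤ - x
  -‿antitone {x} {y} x≤y = begin
    - y      ≡⟨ +-identityˡ (- y) ⟨
    0# - y   ≤⟨ ≤.subtractʳ (subst (0# ≤_) (+-comm y (- x)) (≤.toDifference x≤y)) ⟩
    - x      ∎
    where open ≤-Reasoning

  x<x+δ : ∀ {δ} x → 0# < δ → x < x + δ
  x<x+δ {δ} x 0<δ = begin-strict
    x       ≡⟨ +-identityˡ x ⟨
    0# + x  <⟨ +-mono-< x 0<δ ⟩
    δ + x   ≡⟨ +-comm δ x ⟩
    x + δ   ∎
    where open ≤-Reasoning

  x-δ<x : ∀ {δ} x → 0# < δ → x - δ < x
  x-δ<x x 0<δ = <.subtractʳ (x<x+δ x 0<δ)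

  ∣-∣<⇒between : ∀ {x y ε} → ∣ x - y ∣< ε → (y - ε < x) × (x < y + ε)
  ∣-∣<⇒between {x} {y} {ε} (lower , upper) =
    subst (_< x) (+-comm (- ε) y) (<.addˡ lower) , subst (x <_) (+-comm ε y) (<.addʳ upper)

  between⇒∣-∣< : ∀ {x y ε} → y - ε < x → x < y + ε → ∣ x - y ∣< ε
  between⇒∣-∣< {x} {y} {ε} lower upper =
    <.subtractˡ (subst (_< x) (+-comm y (- ε)) lower) , <.subtractʳ (subst (x <_) (+-comm y ε) upper)

  ∣-∣<-weaken : ∀ {d ε ε'} → ∣ d ∣< ε → ε ≤ ε' → ∣ d ∣< ε'
  ∣-∣<-weaken (lower , upper) ε≤ε' = ≤-<-trans (-‿antitone ε≤ε') lower , <-≤-trans upper ε≤ε'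

  ∣-∣<-triangle : ∀ {x c L e} → ∣ x - c ∣< e → (c - e ≤ L) × (L ≤ c + e) → ∣ x - L ∣< (e + e)
  ∣-∣<-triangle {x} {c} {L} {e} x≈c (lower-L , upper-L) = between⇒∣-∣< lower upper
    where
    open ≤-Reasoning
    x-near = ∣-∣<⇒between x≈c
    lower : L - (e + e) < x
    lower = begin-strict
      L - (e + e)      ≡⟨ cong (L +_) (-‿+-comm e e) ⟨
      L + (- e + - e)  ≡⟨ +-assoc L (- e) (- e) ⟨
      (L - e) - e      ≤⟨ +-mono-≤ (- e) (≤.subtractʳ upper-L) ⟩
      c - e            <⟨ proj₁ x-near ⟩
      x                ∎
    upper : x < L + (e + e)
    upper = begin-strict
      x                <⟨ proj₂ x-near ⟩
      c + e            ≤⟨ +-mono-≤ e (≤.addʳ lower-L) ⟩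
      L + e + e        ≡⟨ +-assoc L e e ⟩
      L + (e + e)      ∎

  *-monoʳ-≤ : ∀ {x y} z → 0# ≤ z → x ≤ y → x * z ≤ y * z
  *-monoʳ-≤ {x} {y} z 0≤z x≤y =
    ≤.fromDifference (subst (0# ≤_) ([y-z]x≈yx-zx z y x) (*-nonneg (≤.toDifference x≤y) 0≤z))

  square-nonneg : ∀ x → 0# ≤ x * x
  square-nonneg x with total 0# x
  ... | inj₁ 0≤x = *-nonneg 0≤x 0≤x
  ... | inj₂ x≤0 = subst (0# ≤_) (-x*-x≡x*x) (*-nonneg 0≤-x 0≤-x)
    where
    0≤-x : 0# ≤ - x
    0≤-x = subst (_≤ - x) -0#≈0# (-‿antitone x≤0)
    -x*-x≡x*x : - x * - x ≡ x * x
    -x*-x≡x*x = trans (sym (-‿distribˡ-* x (- x)))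
                  (trans (cong -_ (sym (-‿distribʳ-* x x))) (-‿involutive (x * x)))

  0<1 : 0# < 1#
  0<1 = subst (0# ≤_) (*-identityˡ 1#) (square-nonneg 1#) , 0≢1

  inverse-positive : ∀ {x y} → 0# < x → x * y ≡ 1# → 0# < y
  inverse-positive {x} {y} (0≤x , _) xy≡1 = 0≤y , 0≢y
    where
    0≤y : 0# ≤ y
    0≤y with total 0# y
    ... | inj₁ 0≤y = 0≤y
    ... | inj₂ y≤0 = ⊥-elim (0≢1 (antisym (proj₁ 0<1) 1≤0))
      where
      0≤-1 : 0# ≤ - 1#
      0≤-1 = subst (0# ≤_) (trans (sym (-‿distribʳ-* x y)) (cong -_ xy≡1))
               (*-nonneg 0≤x (subst (_≤ - y) -0#≈0# (-‿antitone y≤0)))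
      1≤0 : 1# ≤ 0#
      1≤0 = begin
        1#      ≡⟨ -‿involutive 1# ⟨
        - - 1#  ≤⟨ -‿antitone 0≤-1 ⟩
        - 0#    ≡⟨ -0#≈0# ⟩
        0#      ∎
        where open ≤-Reasoning
    0≢y : ¬ (0# ≡ y)
    0≢y 0≡y = 0≢1 (trans (sym (zeroʳ x)) (trans (cong (x *_) 0≡y) xy≡1))

  recip : (x : Carrier) → 0# < x → Carrier
  recip x (_ , 0≢x) = proj₁ (inverse x (λ x≡0 → 0≢x (sym x≡0)))

  recip-inverse : ∀ {x} (0<x : 0# < x) → x * recip x 0<x ≡ 1#
  recip-inverse {x} (_ , 0≢x) = proj₂ (inverse x (λ x≡0 → 0≢x (sym x≡0)))

  recip-positive : ∀ {x} (0<x : 0# < x) → 0# < recip x 0<x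
  recip-positive 0<x = inverse-positive 0<x (recip-inverse 0<x)

  reciprocal-antitone : ∀ {x x' y y'} → 0# < x → x * x' ≡ 1# → y * y' ≡ 1# → x ≤ y → y' ≤ x'
  reciprocal-antitone {x} {x'} {y} {y'} 0<x xx'≡1 yy'≡1 x≤y = begin
    y'              ≡⟨ *-identityˡ y' ⟨
    1# * y'         ≡⟨ cong (_* y') xx'≡1 ⟨
    x * x' * y'     ≡⟨ *-assoc x x' y' ⟩
    x * (x' * y')   ≤⟨ *-monoʳ-≤ (x' * y') 0≤x'y' x≤y ⟩
    y * (x' * y')   ≡⟨ x∙yz≈y∙xz y x' y' ⟩
    x' * (y * y')   ≡⟨ cong (x' *_) yy'≡1 ⟩
    x' * 1#         ≡⟨ *-identityʳ x' ⟩
    x'              ∎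
    where
    open ≤-Reasoning
    0≤x'y' : 0# ≤ x' * y'
    0≤x'y' = *-nonneg (proj₁ (inverse-positive 0<x xx'≡1))
                      (proj₁ (inverse-positive (<-≤-trans 0<x x≤y) yy'≡1))

  halve : ∀ {ε} → 0# < ε → ∃ λ δ → 0# < δ × δ + δ ≡ ε
  halve {ε} 0<ε = δ , 0<δ , δ+δ≡ε
    where
    open ≡-Reasoning
    0<2 : 0# < 1# + 1#
    0<2 = <-≤-trans 0<1 (subst (_≤ 1# + 1#) (+-identityˡ 1#) (+-mono-≤ 1# (proj₁ 0<1)))
    h = recip (1# + 1#) 0<2
    δ = ε * h
    δ+δ≡ε : δ + δ ≡ ε
    δ+δ≡ε = begin
      ε * h + ε * h          ≡⟨ distribˡ ε h h ⟨
      ε * (h + h)            ≡⟨ cong (ε *_) (cong₂ _+_ (*-identityˡ h) (*-identityˡ h)) ⟨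
      ε * (1# * h + 1# * h)  ≡⟨ cong (ε *_) (distribʳ h 1# 1#) ⟨
      ε * ((1# + 1#) * h)    ≡⟨ cong (ε *_) (recip-inverse 0<2) ⟩
      ε * 1#                 ≡⟨ *-identityʳ ε ⟩
      ε                      ∎
    0<δ : 0# < δ
    0<δ = *-nonneg (proj₁ 0<ε) (proj₁ (recip-positive 0<2)) ,
          λ 0≡δ → proj₂ 0<ε (trans (sym (+-identityʳ 0#)) (trans (cong₂ _+_ 0≡δ 0≡δ) δ+δ≡ε))

module CantorCompleteFields {ℓ : Level} (K : OrderedField ℓ) where
  open OrderedField K
  open OrderedFieldFacts K

  BoundedAbove : (ℕ → Carrier) → Set ℓ
  BoundedAbove s = ∃ λ c → ∀ n → s n ≤ c

  ArbitrarilySmall : (ℕ → Carrier) → Set ℓ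
  ArbitrarilySmall e = (∀ k → 0# < e k) × (∀ ε → 0# < ε → ∃ λ k → e k ≤ ε)

  closedFIP-byDomination : ∀ {a ℓ₁ ℓ₂} (P : TotalPreorder a ℓ₁ ℓ₂)
    (f : ℕ → TotalPreorder.Carrier P) (lo hi p : ℕ → Carrier) →
    (∀ {i k} → TotalPreorder._≲_ P (f i) (f k) → (lo i ≤ p k) × (p k ≤ hi i)) →
    ClosedFIP K lo hi
  closedFIP-byDomination P f lo hi p covers F with dominatingIndex P f F
  ... | k , below-k = p k , All.map covers below-k

  increasingMajorant : (ℕ → Carrier) → ℕ → Carrier
  increasingMajorant u zero = u zero
  increasingMajorant u (sucℕ n) = (increasingMajorant u n ⊔ u (sucℕ n)) + 1#

  increasingMajorant-increasing : ∀ u → StrictlyIncreasing K (increasingMajorant u)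
  increasingMajorant-increasing u n =
    ≤-<-trans (x≤x⊔y _ (u (sucℕ n))) (x<x+δ _ 0<1)

  increasingMajorant-majorises : ∀ u n → u n ≤ increasingMajorant u n
  increasingMajorant-majorises u zero = ≤-refl
  increasingMajorant-majorises u (sucℕ n) =
    ≤-trans (x≤y⊔x (increasingMajorant u n) (u (sucℕ n))) (proj₁ (x<x+δ _ 0<1))

  unbounded⇒increasingUnbounded : ∃ (Unbounded K) → ∃ λ s → StrictlyIncreasing K s × Unbounded K s
  unbounded⇒increasingUnbounded (u , u-unbounded) =
    increasingMajorant u , increasingMajorant-increasing u ,
    λ c → proj₁ (u-unbounded c) ,
          <-≤-trans (proj₂ (u-unbounded c)) (increasingMajorant-majorises u _)

  unbounded⇒arbitrarilySmall : ∃ (Unbounded K) → ∃ ArbitrarilySmall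
  unbounded⇒arbitrarilySmall (u , u-unbounded) = e , (λ k → recip-positive (0<p k)) , small
    where
    p : ℕ → Carrier
    p k = u k ⊔ 1#
    0<p : ∀ k → 0# < p k
    0<p k = <-≤-trans 0<1 (x≤y⊔x (u k) 1#)
    e : ℕ → Carrier
    e k = recip (p k) (0<p k)
    small : ∀ ε → 0# < ε → ∃ λ k → e k ≤ ε
    small ε 0<ε with u-unbounded (recip ε 0<ε)
    ... | k , 1/ε<uk =
      k , reciprocal-antitone (recip-positive 0<ε) (trans (*-comm _ ε) (recip-inverse 0<ε))
                              (recip-inverse (0<p k)) (≤-trans (proj₁ 1/ε<uk) (x≤x⊔y (u k) 1#))

  cantor⇒sequentiallyComplete : CantorComplete K → ∃ ArbitrarilySmall → SequentiallyComplete K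
  cantor⇒sequentiallyComplete cantor (e , e-positive , e-small) s cauchy = L , convergence
    where
    N : ℕ → ℕ
    N k = proj₁ (cauchy (e k) (e-positive k))
    close : ∀ k {n m} → N k ≤ℕ n → N k ≤ℕ m → ∣ s n - s m ∣< e k
    close k = proj₂ (cauchy (e k) (e-positive k)) _ _
    -- s (N k) lies in the interval of index i whenever N i ≤ N k.
    centred : ClosedFIP K (λ k → s (N k) - e k) (λ k → s (N k) + e k)
    centred = closedFIP-byDomination ℕ.≤-totalPreorder N _ _ (λ k → s (N k))
      λ {i} Ni≤Nk → let (lower , upper) = ∣-∣<⇒between (close i Ni≤Nk ℕ.≤-refl)
                    in proj₁ lower , proj₁ upper
    L : Carrier
    L = proj₁ (cantor _ _ centred)
    convergence : ConvergesTo K s L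
    convergence ε 0<ε with halve 0<ε
    ... | η , 0<η , η+η≡ε with e-small η 0<η
    ... | k , ek≤η = N k , λ n Nk≤n →
      ∣-∣<-weaken (∣-∣<-triangle (close k Nk≤n ℕ.≤-refl) (proj₂ (cantor _ _ centred) k))
                  (subst (e k + e k ≤_) η+η≡ε (+-mono-≤₂ ek≤η ek≤η))

  -- If every sequence is bounded above, a doubly indexed family of positive
  -- elements has a positive lower bound: bound the reciprocals by a single C
  -- and take 1 / C.
  uniformPositiveLowerBound : (∀ s → BoundedAbove s) → (d : ℕ → ℕ → Carrier) →
    (∀ k j → 0# < d k j) → ∃ λ ε → 0# < ε × (∀ k j → ε ≤ d k j)
  uniformPositiveLowerBound bounded d 0<d = recip C 0<C , recip-positive 0<C , ε≤d
    where
    r : ℕ → ℕ → Carrier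
    r k j = recip (d k j) (0<d k j)
    B : ℕ → Carrier
    B k = proj₁ (bounded (r k))
    C : Carrier
    C = proj₁ (bounded B)
    r≤C : ∀ k j → r k j ≤ C
    r≤C k j = ≤-trans (proj₂ (bounded (r k)) j) (proj₂ (bounded B) k)
    0<C : 0# < C
    0<C = <-≤-trans (recip-positive (0<d 0 0)) (r≤C 0 0)
    ε≤d : ∀ k j → recip C 0<C ≤ d k j
    ε≤d k j = reciprocal-antitone (recip-positive (0<d k j))
                (trans (*-comm _ (d k j)) (recip-inverse (0<d k j))) (recip-inverse 0<C) (r≤C k j)

  openFIP⇒separated : ∀ {a b} → OpenFIP K a b → ∀ k j → a k < b j
  openFIP⇒separated fip k j with fip (k ∷ j ∷ [])
  ... | _ , (ak<x , _) ∷ (_ , x<bj) ∷ [] = <-≤-trans ak<x (proj₁ x<bj)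

  cantor⇒commonPoint : CantorComplete K → (a b : ℕ → Carrier) {δ : Carrier} → 0# < δ →
    (∀ k j → a k + δ ≤ b j - δ) → ∃ λ x → ∀ i → (a i < x) × (x < b i)
  cantor⇒commonPoint cantor a b {δ} 0<δ shrunk = x , inside
    where
    nested : ClosedFIP K (λ i → a i + δ) (λ i → b i - δ)
    nested = closedFIP-byDomination totalPreorder a _ _ (λ k → a k + δ)
               λ {i} {k} ai≤ak → +-mono-≤ δ ai≤ak , shrunk k i
    x : Carrier
    x = proj₁ (cantor _ _ nested)
    inside : ∀ i → (a i < x) × (x < b i)
    inside i = <-≤-trans (x<x+δ (a i) 0<δ) (proj₁ (proj₂ (cantor _ _ nested) i)) ,
               ≤-<-trans (proj₂ (proj₂ (cantor _ _ nested) i)) (x-δ<x (b i) 0<δ)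

  cantor⇒saturated : CantorComplete K → (∀ s → BoundedAbove s) → AlgebraicallySaturated K
  cantor⇒saturated cantor bounded a b fip
    with uniformPositiveLowerBound bounded (λ k j → b j - a k)
           (λ k j → <.toDifference (openFIP⇒separated fip k j))
  ... | ε , 0<ε , ε≤gap with halve 0<ε
  ... | δ , 0<δ , δ+δ≡ε = cantor⇒commonPoint cantor a b 0<δ shrunk
    where
    shrunk : ∀ k j → a k + δ ≤ b j - δ
    shrunk k j = ≤.subtractˡ (begin
      a k + δ + δ    ≡⟨ +-assoc (a k) δ δ ⟩
      a k + (δ + δ)  ≡⟨ cong (a k +_) δ+δ≡ε ⟩
      a k + ε        ≡⟨ +-comm (a k) ε ⟩
      ε + a k        ≤⟨ ≤.addˡ (ε≤gap k j) ⟩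
      b j            ∎)
      where open ≤-Reasoning

-- The only classical step: a field without unbounded sequences has every
-- sequence bounded above, so a Cantor complete, non-saturated field has an
-- unbounded sequence.
module Classical {ℓ : Level} (lem : ExcludedMiddle ℓ) (K : OrderedField ℓ) where
  open OrderedField K
  open OrderedFieldFacts K
  open CantorCompleteFields K

  ≮⇒≥ : ∀ {x y} → ¬ (x < y) → y ≤ x
  ≮⇒≥ {x} {y} x≮y with total x y
  ... | inj₂ y≤x = y≤x
  ... | inj₁ x≤y with lem {x ≡ y}
  ...   | yes x≡y = ≤-reflexive (sym x≡y)
  ...   | no x≢y = ⊥-elim (x≮y (x≤y , x≢y))

  noUnbounded⇒bounded : ¬ ∃ (Unbounded K) → ∀ s → BoundedAbove s
  noUnbounded⇒bounded noUnbounded s = em⇒dne lem λ notBounded →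
    noUnbounded (s , λ c → em⇒dne lem λ noneAbove →
      notBounded (c , λ n → ≮⇒≥ λ c<sn → noneAbove (n , c<sn)))

  unboundedSequence : CantorComplete K → ¬ AlgebraicallySaturated K → ∃ (Unbounded K)
  unboundedSequence cantor notSaturated = em⇒dne lem λ noUnbounded →
    notSaturated (cantor⇒saturated cantor (noUnbounded⇒bounded noUnbounded))

corollary6p5 : {ℓ : Level} → ExcludedMiddle ℓ → (K : OrderedField ℓ) →
    CantorComplete K → ¬ AlgebraicallySaturated K →
    (∃ λ s → StrictlyIncreasing K s × Unbounded K s) × SequentiallyComplete K
corollary6p5 lem K cantor notSaturated =
  unbounded⇒increasingUnbounded unbounded ,
  cantor⇒sequentiallyComplete cantor (unbounded⇒arbitrarilySmall unbounded)
  where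
  open CantorCompleteFields K
  unbounded : ∃ (Unbounded K)
  unbounded = Classical.unboundedSequence lem K cantor notSaturated
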